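{- Let $N\ge 1$ be a natural number. Then $N$ has a representation $N=\sum_{i=R}^{L} c_i\varphi^i$ (finitely many nonzero terms) with all digits $c_i\in\{0,1\}$, $c_1=c_0=1$, and $c_{i+1}c_i\neq 11$ for every $i\neq 0$, if and only if the Bergman representation $\beta(N)=d_L\dots d_1d_0\cdot d_{ -1}\dots d_R$ of $N$ satisfies $d_1=d_0=d_{ -1}=0$.
   Context: Let $\varphi=(1+\sqrt5)/2$. The Bergman representation $\beta(N)=d_Ld_{L-1}\dots d_1d_0\cdot d_{ -1}\dots d_R$ of a natural number $N$ is the unique finite expansion $N=\sum_{i=R}^{L} d_i\varphi^i$ with digits $d_i\in\{0,1\}$ in which no two consecutive digits $d_{i+1}d_i$ equal $11$; here $L$ is the largest and $R$ the smallest index with a nonzero digit, and the point separates the digit with index $0$ from the digit with index $-1$. Digits outside $[R,L]$ are $0$. -}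

module Defs where

open import Data.Bool using (Bool; true; false)
open import Data.Nat as ℕ using (ℕ; zero; suc)
open import Data.Integer as ℤ using (ℤ; +_; -[1+_]; _+_; _-_; _<_; _≤_; 0ℤ; 1ℤ)
open import Data.Product using (_×_; _,_; Σ; ∃)
open import Data.Sum using (_⊎_)
open import Relation.Binary.PropositionalEquality using (_≡_; _≢_)
open import Relation.Nullary using (¬_)

-- The ring ℤ[φ], φ = (1+√5)/2, φ² = φ + 1.
-- An element  a + b·φ  is stored as the pair (a , b).  Since φ is
-- irrational, two such reals are equal iff the pairs are equal.
Zφ : Set
Zφ = ℤ × ℤ

_⊕_ : Zφ → Zφ → Zφ
(a , b) ⊕ (c , d) = (a + c , b + d)

zeroφ : Zφ
zeroφ = (0ℤ , 0ℤ)

oneφ : Zφ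
oneφ = (1ℤ , 0ℤ)

ℕ→Zφ : ℕ → Zφ
ℕ→Zφ n = (+ n , 0ℤ)

-- multiplication by φ :  (a + bφ)φ = b + (a+b)φ
mulφ : Zφ → Zφ
mulφ (a , b) = (b , a + b)

-- division by φ (φ⁻¹ = φ - 1) :  (a + bφ)/φ = (b - a) + aφ
divφ : Zφ → Zφ
divφ (a , b) = (b - a , a)

iter : (Zφ → Zφ) → ℕ → Zφ → Zφ
iter f zero    x = x
iter f (suc n) x = f (iter f n x)

φ^ : ℤ → Zφ
φ^ (+ n)     = iter mulφ n oneφ
φ^ -[1+ n ]  = iter divφ (suc n) oneφ

digit : Bool → Zφ → Zφ
digit true  x = x
digit false _ = zeroφ

-- A finite φ-expansion: digit function c : ℤ → {0,1} (Bool, true = 1)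
-- together with a window [R, R+n) outside of which all digits are 0.
record Expansion : Set where
  field
    c       : ℤ → Bool
    R       : ℤ
    n       : ℕ
    support : ∀ i → (i < R ⊎ R + + n ≤ i) → c i ≡ false

windowSum : (ℤ → Bool) → ℤ → ℕ → Zφ
windowSum c R zero    = zeroφ
windowSum c R (suc m) = windowSum c R m ⊕ digit (c (R + + m)) (φ^ (R + + m))

value : Expansion → Zφ
value e = windowSum (Expansion.c e) (Expansion.R e) (Expansion.n e)

Has11At : (ℤ → Bool) → ℤ → Set
Has11At c i = (c (i + 1ℤ) ≡ true) × (c i ≡ true)

IsBergman : ℕ → Expansion → Set
IsBergman N e = (value e ≡ ℕ→Zφ N) × (∀ i → ¬ Has11At (Expansion.c e) i)

IsSpecialRep : ℕ → Expansion → Set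
IsSpecialRep N e =
  (value e ≡ ℕ→Zφ N)
  × (Expansion.c e 1ℤ ≡ true) × (Expansion.c e 0ℤ ≡ true)
  × (∀ i → i ≢ 0ℤ → ¬ Has11At (Expansion.c e) i)

-- Reading the digits from index −M on turns the value of an expansion into φ⁻ᴹ Σₖ dₖ φᵏ with k ∈ ℕ.
-- Digit strings without "11" are determined by their value, since such a string of length n is worth less
-- than φⁿ.
-- (⇒) In a special representation, carry the "11" at positions 0, 1 upwards (1 + φ = φ², so the digits
-- 1 1 0 at Q, Q + 1, Q + 2 may be replaced by 0 0 1) until no "11" is left. The result is β(N), and its
-- digits at −1, 0, 1 are 0.
-- (⇐) Let j ≥ 2 be the position of the lowest 1 of β(N) above the point (there is one, as N ≥ 1 > φ⁻¹).
-- If j is even, uncarrying moves this 1 down to a "11" at positions 0, 1. If j is odd, write N = y + φʲ z,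
-- where 0 ≤ y < φ⁻¹ collects the digits below the point and z those from position j on. As z has no "11"
-- and starts with a 1, conj z ∈ (0, φ), so conj (φʲ z) = ψʲ conj z ∈ (−φ⁻², 0) with ψ = −φ⁻¹, and
-- y − conj (φʲ z) = N − (φʲ z + conj (φʲ z)) would be an integer strictly between 0 and 1.

module Submission where

open import Defs
open import Data.Bool using (Bool; true; false)
open import Data.Nat using (ℕ; _≥_)
open import Data.Integer using (0ℤ; 1ℤ; -1ℤ)
open import Data.Product using (_×_; ∃)
open import Function.Bundles using (_⇔_; mk⇔)
open import Relation.Binary.PropositionalEquality using (_≡_)

open import Data.Empty using (⊥; ⊥-elim)
open import Function using (_∘_)
open import Data.Integer as ℤ using (ℤ; +_; -[1+_]; _+_; _-_; -_; ∣_∣)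
import Data.Integer.Properties as ℤP
open import Data.Integer.Tactic.RingSolver using (solve-∀)
import Data.Nat.Tactic.RingSolver as ℕ-Solver
open import Data.Nat as ℕ using (zero; suc; z≤n; s≤s)
import Data.Nat.Properties as ℕP
open import Data.Product using (_,_; proj₁; proj₂)
open import Data.Sum using (_⊎_; inj₁; inj₂)
open import Relation.Binary.PropositionalEquality
  using (_≢_; refl; sym; trans; cong; cong₂; subst; subst₂; module ≡-Reasoning)
open import Relation.Nullary using (¬_; yes; no)

infixl 6 _⊖_
infix 4 _<φ_ _≤φ_

-- Arithmetic in ℤ[φ]

-φ_ : Zφ → Zφ
-φ (a , b) = (- a , - b)

_⊖_ : Zφ → Zφ → Zφ
u ⊖ v = u ⊕ (-φ v)

φ φ⁻¹ φ⁻² : Zφ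
φ = φ^ (+ 1)
φ⁻¹ = φ^ -1ℤ
φ⁻² = φ^ -[1+ 1 ]

⊕-comm : ∀ u v → u ⊕ v ≡ v ⊕ u
⊕-comm (a , b) (c , d) = cong₂ _,_ (ℤP.+-comm a c) (ℤP.+-comm b d)

⊕-assoc : ∀ u v w → (u ⊕ v) ⊕ w ≡ u ⊕ (v ⊕ w)
⊕-assoc (a , b) (c , d) (e , f) = cong₂ _,_ (ℤP.+-assoc a c e) (ℤP.+-assoc b d f)

⊕-identityˡ : ∀ u → zeroφ ⊕ u ≡ u
⊕-identityˡ (a , b) = cong₂ _,_ (ℤP.+-identityˡ a) (ℤP.+-identityˡ b)

⊕-identityʳ : ∀ u → u ⊕ zeroφ ≡ u
⊕-identityʳ (a , b) = cong₂ _,_ (ℤP.+-identityʳ a) (ℤP.+-identityʳ b)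

⊖-self : ∀ u → u ⊖ u ≡ zeroφ
⊖-self (a , b) = cong₂ _,_ (ℤP.+-inverseʳ a) (ℤP.+-inverseʳ b)

⊖-telescope : ∀ u v w → w ⊖ u ≡ (w ⊖ v) ⊕ (v ⊖ u)
⊖-telescope (a , b) (c , d) (e , f) = cong₂ _,_ (h a c e) (h b d f)
  where h : ∀ a c e → e + - a ≡ (e + - c) + (c + - a)
        h = solve-∀

⊕-⊖-cancelʳ : ∀ u v w → (u ⊕ w) ⊖ (v ⊕ w) ≡ u ⊖ v
⊕-⊖-cancelʳ (a , b) (c , d) (e , f) = cong₂ _,_ (h a c e) (h b d f)
  where h : ∀ a c e → (a + e) + - (c + e) ≡ a + - c
        h = solve-∀

⊕-⊖-cancelˡ : ∀ u v w → (w ⊕ u) ⊖ (w ⊕ v) ≡ u ⊖ v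
⊕-⊖-cancelˡ (a , b) (c , d) (e , f) = cong₂ _,_ (h a c e) (h b d f)
  where h : ∀ a c e → (e + a) + - (e + c) ≡ a + - c
        h = solve-∀

⊕-⊖-inverse : ∀ u w → (u ⊕ w) ⊖ w ≡ u
⊕-⊖-inverse (a , b) (c , d) = cong₂ _,_ (h a c) (h b d)
  where h : ∀ a c → (a + c) + - c ≡ a
        h = solve-∀

⊕-cancelʳ : ∀ u v w → u ⊕ w ≡ v ⊕ w → u ≡ v
⊕-cancelʳ u v w eq = trans (sym (⊕-⊖-inverse u w)) (trans (cong (_⊖ w) eq) (⊕-⊖-inverse v w))

mulφ-⊕ : ∀ u v → mulφ (u ⊕ v) ≡ mulφ u ⊕ mulφ v
mulφ-⊕ (a , b) (c , d) = cong₂ _,_ refl (h a b c d)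
  where h : ∀ a b c d → (a + c) + (b + d) ≡ (a + b) + (c + d)
        h = solve-∀

divφ-⊕ : ∀ u v → divφ (u ⊕ v) ≡ divφ u ⊕ divφ v
divφ-⊕ (a , b) (c , d) = cong₂ _,_ (h a b c d) refl
  where h : ∀ a b c d → (b + d) - (a + c) ≡ (b - a) + (d - c)
        h = solve-∀

divφ-⊖ : ∀ u v → divφ (u ⊖ v) ≡ divφ u ⊖ divφ v
divφ-⊖ (a , b) (c , d) = cong₂ _,_ (h a b c d) refl
  where h : ∀ a b c d → (b + - d) - (a + - c) ≡ (b - a) + - (d - c)
        h = solve-∀

mulφ-divφ : ∀ u → mulφ (divφ u) ≡ u
mulφ-divφ (a , b) = cong₂ _,_ refl (h a b)
  where h : ∀ a b → (b - a) + a ≡ b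
        h = solve-∀

divφ-mulφ : ∀ u → divφ (mulφ u) ≡ u
divφ-mulφ (a , b) = cong₂ _,_ (h a b) refl
  where h : ∀ a b → (a + b) - b ≡ a
        h = solve-∀

mulφ-⊖-self : ∀ u → mulφ u ⊖ u ≡ divφ u
mulφ-⊖-self (a , b) = cong₂ _,_ (h a b) (h′ a b)
  where h : ∀ a b → b + - a ≡ b - a
        h = solve-∀
        h′ : ∀ a b → (a + b) + - b ≡ a
        h′ = solve-∀

iter-comm : ∀ (f : Zφ → Zφ) k x → iter f k (f x) ≡ f (iter f k x)
iter-comm f zero    x = refl
iter-comm f (suc k) x = cong f (iter-comm f k x)

iter-+ : ∀ (f : Zφ → Zφ) k l x → iter f (k ℕ.+ l) x ≡ iter f k (iter f l x)
iter-+ f zero    l x = refl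
iter-+ f (suc k) l x = cong f (iter-+ f k l x)

iter-⊕ : ∀ (f : Zφ → Zφ) → (∀ u v → f (u ⊕ v) ≡ f u ⊕ f v) →
         ∀ k u v → iter f k (u ⊕ v) ≡ iter f k u ⊕ iter f k v
iter-⊕ f f-⊕ zero    u v = refl
iter-⊕ f f-⊕ (suc k) u v = trans (cong f (iter-⊕ f f-⊕ k u v)) (f-⊕ _ _)

iter-fix : ∀ (f : Zφ → Zφ) {x} → f x ≡ x → ∀ k → iter f k x ≡ x
iter-fix f fx≡x zero    = refl
iter-fix f fx≡x (suc k) = trans (cong f (iter-fix f fx≡x k)) fx≡x

iter-divφ-mulφ : ∀ k u → iter divφ k (iter mulφ k u) ≡ u
iter-divφ-mulφ zero    u = refl
iter-divφ-mulφ (suc k) u = begin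
  divφ (iter divφ k (mulφ (iter mulφ k u))) ≡⟨ cong (λ v → divφ (iter divφ k v)) (sym (iter-comm mulφ k u)) ⟩
  divφ (iter divφ k (iter mulφ k (mulφ u))) ≡⟨ cong divφ (iter-divφ-mulφ k (mulφ u)) ⟩
  divφ (mulφ u)                             ≡⟨ divφ-mulφ u ⟩
  u                                         ∎
  where open ≡-Reasoning

iter-mulφ-injective : ∀ k {u v} → iter mulφ k u ≡ iter mulφ k v → u ≡ v
iter-mulφ-injective k {u} {v} eq =
  trans (sym (iter-divφ-mulφ k u)) (trans (cong (iter divφ k) eq) (iter-divφ-mulφ k v))

unscale : ∀ k u v w → u ⊕ iter mulφ k v ≡ iter mulφ k w → iter divφ k u ⊕ v ≡ w
unscale k u v w eq = begin
  iter divφ k u ⊕ v                              ≡⟨ cong (iter divφ k u ⊕_) (sym (iter-divφ-mulφ k v)) ⟩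
  iter divφ k u ⊕ iter divφ k (iter mulφ k v)    ≡⟨ sym (iter-⊕ divφ divφ-⊕ k u _) ⟩
  iter divφ k (u ⊕ iter mulφ k v)                ≡⟨ cong (iter divφ k) eq ⟩
  iter divφ k (iter mulφ k w)                    ≡⟨ iter-divφ-mulφ k w ⟩
  w                                              ∎
  where open ≡-Reasoning

-- Positivity and order

Coords⁺ : Zφ → Set
Coords⁺ (+ a , + b) = 1 ℕ.≤ a ℕ.+ b
Coords⁺ _           = ⊥

-- u > 0 as a real number, witnessed by a power φᵏ for which φᵏu has nonnegative coordinates.
Pos : Zφ → Set
Pos u = ∃ λ k → Coords⁺ (iter mulφ k u)

Coords⁺-mulφ : ∀ u → Coords⁺ u → Coords⁺ (mulφ u)
Coords⁺-mulφ (+ a , + b) 1≤a+b = ℕP.≤-trans 1≤a+b (ℕP.m≤n+m (a ℕ.+ b) b)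

Coords⁺-⊕ : ∀ u v → Coords⁺ u → Coords⁺ v → Coords⁺ (u ⊕ v)
Coords⁺-⊕ (+ a , + b) (+ c , + d) 1≤a+b _ =
  ℕP.≤-trans 1≤a+b (ℕP.+-mono-≤ (ℕP.m≤m+n a c) (ℕP.m≤m+n b d))

Coords⁺-iter-mulφ : ∀ k u → Coords⁺ u → Coords⁺ (iter mulφ k u)
Coords⁺-iter-mulφ zero    u c = c
Coords⁺-iter-mulφ (suc k) u c = Coords⁺-mulφ _ (Coords⁺-iter-mulφ k u c)

Pos-mulφ : ∀ {u} → Pos u → Pos (mulφ u)
Pos-mulφ {u} (k , c) = k , subst Coords⁺ (sym (iter-comm mulφ k u)) (Coords⁺-mulφ _ c)

Pos-divφ : ∀ {u} → Pos u → Pos (divφ u)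
Pos-divφ {u} (k , c) = suc k , subst Coords⁺ φᵏu≡φᵏ⁺¹u/φ c
  where φᵏu≡φᵏ⁺¹u/φ : iter mulφ k u ≡ iter mulφ (suc k) (divφ u)
        φᵏu≡φᵏ⁺¹u/φ = trans (cong (iter mulφ k) (sym (mulφ-divφ u))) (iter-comm mulφ k (divφ u))

Pos-iter : ∀ {f} → (∀ {u} → Pos u → Pos (f u)) → ∀ k {u} → Pos u → Pos (iter f k u)
Pos-iter f-pos zero    p = p
Pos-iter f-pos (suc k) p = f-pos (Pos-iter f-pos k p)

Pos-⊕ : ∀ {u v} → Pos u → Pos v → Pos (u ⊕ v)
Pos-⊕ {u} {v} (k , cu) (l , cv) = k ℕ.+ l , subst Coords⁺ (sym φᵏ⁺ˡ[u⊕v]) (Coords⁺-⊕ _ _ cu′ cv′)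
  where
    cu′ : Coords⁺ (iter mulφ l (iter mulφ k u))
    cu′ = Coords⁺-iter-mulφ l _ cu
    cv′ : Coords⁺ (iter mulφ k (iter mulφ l v))
    cv′ = Coords⁺-iter-mulφ k _ cv
    φᵏ⁺ˡ[u⊕v] : iter mulφ (k ℕ.+ l) (u ⊕ v) ≡ iter mulφ l (iter mulφ k u) ⊕ iter mulφ k (iter mulφ l v)
    φᵏ⁺ˡ[u⊕v] = trans (iter-⊕ mulφ mulφ-⊕ (k ℕ.+ l) u v)
                  (cong₂ _⊕_ (trans (cong (λ n → iter mulφ n u) (ℕP.+-comm k l)) (iter-+ mulφ l k u))
                             (iter-+ mulφ k l v))

¬Pos-zeroφ : ¬ Pos zeroφ
¬Pos-zeroφ (k , c) with () ← subst Coords⁺ (iter-fix mulφ refl k) c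

record _<φ_ (u v : Zφ) : Set where
  constructor mk<φ
  field pos : Pos (v ⊖ u)
open _<φ_

_≤φ_ : Zφ → Zφ → Set
u ≤φ v = u ≡ v ⊎ u <φ v

⊖-zeroφ : ∀ u → u ⊖ zeroφ ≡ u
⊖-zeroφ (a , b) = cong₂ _,_ (ℤP.+-identityʳ a) (ℤP.+-identityʳ b)

Pos⇒0<φ : ∀ {u} → Pos u → zeroφ <φ u
Pos⇒0<φ {u} p = mk<φ (subst Pos (sym (⊖-zeroφ u)) p)

0<φ⇒Pos : ∀ {u} → zeroφ <φ u → Pos u
0<φ⇒Pos {u} (mk<φ p) = subst Pos (⊖-zeroφ u) p

<φ-irrefl : ∀ {u} → ¬ (u <φ u)
<φ-irrefl {u} (mk<φ p) = ¬Pos-zeroφ (subst Pos (⊖-self u) p)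

<φ-trans : ∀ {u v w} → u <φ v → v <φ w → u <φ w
<φ-trans {u} {v} {w} (mk<φ p) (mk<φ q) = mk<φ (subst Pos (sym (⊖-telescope u v w)) (Pos-⊕ q p))

≤φ-<φ-trans : ∀ {u v w} → u ≤φ v → v <φ w → u <φ w
≤φ-<φ-trans (inj₁ refl) v<w = v<w
≤φ-<φ-trans (inj₂ u<v)  v<w = <φ-trans u<v v<w

<φ-≤φ-trans : ∀ {u v w} → u <φ v → v ≤φ w → u <φ w
<φ-≤φ-trans u<v (inj₁ refl) = u<v
<φ-≤φ-trans u<v (inj₂ v<w)  = <φ-trans u<v v<w

⊕-monoˡ-<φ : ∀ {u v} w → u <φ v → u ⊕ w <φ v ⊕ w
⊕-monoˡ-<φ {u} {v} w (mk<φ p) = mk<φ (subst Pos (sym (⊕-⊖-cancelʳ v u w)) p)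

⊕-monoʳ-<φ : ∀ w {u v} → u <φ v → w ⊕ u <φ w ⊕ v
⊕-monoʳ-<φ w {u} {v} (mk<φ p) = mk<φ (subst Pos (sym (⊕-⊖-cancelˡ v u w)) p)

⊕-monoˡ-≤φ : ∀ {u v} w → u ≤φ v → u ⊕ w ≤φ v ⊕ w
⊕-monoˡ-≤φ w (inj₁ refl) = inj₁ refl
⊕-monoˡ-≤φ w (inj₂ u<v)  = inj₂ (⊕-monoˡ-<φ w u<v)

divφ-mono-<φ : ∀ {u v} → u <φ v → divφ u <φ divφ v
divφ-mono-<φ {u} {v} (mk<φ p) = mk<φ (subst Pos (divφ-⊖ v u) (Pos-divφ p))

iter-divφ-mono-<φ : ∀ k {u v} → u <φ v → iter divφ k u <φ iter divφ k v
iter-divφ-mono-<φ zero    u<v = u<v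
iter-divφ-mono-<φ (suc k) u<v = divφ-mono-<φ (iter-divφ-mono-<φ k u<v)

iter-divφ-mono-≤φ : ∀ k {u v} → u ≤φ v → iter divφ k u ≤φ iter divφ k v
iter-divφ-mono-≤φ k (inj₁ refl) = inj₁ refl
iter-divφ-mono-≤φ k (inj₂ u<v)  = inj₂ (iter-divφ-mono-<φ k u<v)

<φ-mulφ : ∀ {u} → Pos u → u <φ mulφ u
<φ-mulφ {u} p = mk<φ (subst Pos (sym (mulφ-⊖-self u)) (Pos-divφ p))

-- Digit sums

Pos-φ^ : ∀ k → Pos (φ^ (+ k))
Pos-φ^ k = Pos-iter Pos-mulφ k (0 , s≤s z≤n)

φ^-fib : ∀ n → φ^ (+ suc (suc n)) ≡ φ^ (+ suc n) ⊕ φ^ (+ n)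
φ^-fib n with φ^ (+ n)
... | (a , b) = cong₂ _,_ (ℤP.+-comm a b) (h a b)
  where h : ∀ a b → b + (a + b) ≡ (a + b) + b
        h = solve-∀

iter-digit : ∀ k b u → iter mulφ k (digit b u) ≡ digit b (iter mulφ k u)
iter-digit k true  u = refl
iter-digit k false u = iter-fix mulφ refl k

digit-≤φ : ∀ b {u} → Pos u → digit b u ≤φ u
digit-≤φ true  p = inj₁ refl
digit-≤φ false p = inj₂ (Pos⇒0<φ p)

digitSum : (ℕ → Bool) → ℕ → Zφ
digitSum d zero    = zeroφ
digitSum d (suc n) = digitSum d n ⊕ digit (d n) (φ^ (+ n))

digitSum-cong : ∀ {d d′} n → (∀ k → k ℕ.< n → d k ≡ d′ k) → digitSum d n ≡ digitSum d′ n
digitSum-cong zero    d≗d′ = refl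
digitSum-cong (suc n) d≗d′ =
  cong₂ (λ s b → s ⊕ digit b (φ^ (+ n)))
        (digitSum-cong n (λ k k<n → d≗d′ k (ℕP.m<n⇒m<1+n k<n))) (d≗d′ n (ℕP.n<1+n n))

digitSum-zeros : ∀ {d} n → (∀ k → k ℕ.< n → d k ≡ false) → digitSum d n ≡ zeroφ
digitSum-zeros {d} n d≗0 = trans (digitSum-cong n d≗0) (zeros n)
  where zeros : ∀ n → digitSum (λ _ → false) n ≡ zeroφ
        zeros zero    = refl
        zeros (suc n) = trans (⊕-identityʳ _) (zeros n)

digitSum-+ : ∀ d n a →
  digitSum d (n ℕ.+ a) ≡ digitSum d a ⊕ iter mulφ a (digitSum (λ k → d (k ℕ.+ a)) n)
digitSum-+ d zero    a = sym (trans (cong (digitSum d a ⊕_) (iter-fix mulφ refl a)) (⊕-identityʳ _))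
digitSum-+ d (suc n) a = begin
  digitSum d (n ℕ.+ a) ⊕ digit b (φ^ (+ (n ℕ.+ a)))
    ≡⟨ cong₂ _⊕_ (digitSum-+ d n a) (cong (digit b) φⁿ⁺ᵃ≡φᵃφⁿ) ⟩
  (digitSum d a ⊕ iter mulφ a S) ⊕ digit b (iter mulφ a (φ^ (+ n)))
    ≡⟨ ⊕-assoc (digitSum d a) (iter mulφ a S) _ ⟩
  digitSum d a ⊕ (iter mulφ a S ⊕ digit b (iter mulφ a (φ^ (+ n))))
    ≡⟨ cong (λ v → digitSum d a ⊕ (iter mulφ a S ⊕ v)) (sym (iter-digit a b _)) ⟩
  digitSum d a ⊕ (iter mulφ a S ⊕ iter mulφ a (digit b (φ^ (+ n))))
    ≡⟨ cong (digitSum d a ⊕_) (sym (iter-⊕ mulφ mulφ-⊕ a S _)) ⟩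
  digitSum d a ⊕ iter mulφ a (S ⊕ digit b (φ^ (+ n)))
    ∎
  where
    open ≡-Reasoning
    b : Bool
    b = d (n ℕ.+ a)
    S : Zφ
    S = digitSum (λ k → d (k ℕ.+ a)) n
    φⁿ⁺ᵃ≡φᵃφⁿ : φ^ (+ (n ℕ.+ a)) ≡ iter mulφ a (φ^ (+ n))
    φⁿ⁺ᵃ≡φᵃφⁿ = trans (cong (λ k → iter mulφ k oneφ) (ℕP.+-comm n a)) (iter-+ mulφ a n oneφ)

digitSum-suc : ∀ d n → digitSum d (suc n) ≡ digit (d 0) oneφ ⊕ mulφ (digitSum (λ k → d (suc k)) n)
digitSum-suc d n = begin
  digitSum d (suc n)
    ≡⟨ cong (digitSum d) (ℕP.+-comm 1 n) ⟩
  digitSum d (n ℕ.+ 1)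
    ≡⟨ digitSum-+ d n 1 ⟩
  (zeroφ ⊕ digit (d 0) oneφ) ⊕ mulφ (digitSum (λ k → d (k ℕ.+ 1)) n)
    ≡⟨ cong₂ _⊕_ (⊕-identityˡ (digit (d 0) oneφ))
                 (cong mulφ (digitSum-cong n (λ k _ → cong d (ℕP.+-comm k 1)))) ⟩
  digit (d 0) oneφ ⊕ mulφ (digitSum (λ k → d (suc k)) n)
    ∎
  where open ≡-Reasoning

digitSum-gap : ∀ d g a → (∀ i → i ℕ.< g → d (i ℕ.+ a) ≡ false) → digitSum d (g ℕ.+ a) ≡ digitSum d a
digitSum-gap d g a gap = begin
  digitSum d (g ℕ.+ a)
    ≡⟨ digitSum-+ d g a ⟩
  digitSum d a ⊕ iter mulφ a (digitSum (λ i → d (i ℕ.+ a)) g)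
    ≡⟨ cong (λ v → digitSum d a ⊕ iter mulφ a v) (digitSum-zeros g gap) ⟩
  digitSum d a ⊕ iter mulφ a zeroφ
    ≡⟨ cong (digitSum d a ⊕_) (iter-fix mulφ refl a) ⟩
  digitSum d a ⊕ zeroφ
    ≡⟨ ⊕-identityʳ (digitSum d a) ⟩
  digitSum d a
    ∎
  where open ≡-Reasoning

0≤φ-⊕ : ∀ {u v} → zeroφ ≤φ u → zeroφ ≤φ v → zeroφ ≤φ u ⊕ v
0≤φ-⊕ {v = v} (inj₁ refl) 0≤v         = subst (zeroφ ≤φ_) (sym (⊕-identityˡ v)) 0≤v
0≤φ-⊕ {u = u} (inj₂ 0<u)  (inj₁ refl) = inj₂ (subst (zeroφ <φ_) (sym (⊕-identityʳ u)) 0<u)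
0≤φ-⊕         (inj₂ 0<u)  (inj₂ 0<v)  = inj₂ (Pos⇒0<φ (Pos-⊕ (0<φ⇒Pos 0<u) (0<φ⇒Pos 0<v)))

0≤φdigitSum : ∀ d n → zeroφ ≤φ digitSum d n
0≤φdigitSum d zero    = inj₁ refl
0≤φdigitSum d (suc n) = 0≤φ-⊕ (0≤φdigitSum d n) (0≤φdigit (d n))
  where 0≤φdigit : ∀ b → zeroφ ≤φ digit b (φ^ (+ n))
        0≤φdigit true  = inj₂ (Pos⇒0<φ (Pos-φ^ n))
        0≤φdigit false = inj₁ refl

-- Digit strings without "11"

record Has11 (d : ℕ → Bool) (k : ℕ) : Set where
  constructor has11
  field
    upper : d (suc k) ≡ true
    lower : d k ≡ true

No11 : (ℕ → Bool) → Set
No11 d = ∀ k → ¬ Has11 d k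

¬Has11⇒upper-zero : ∀ {d k} → ¬ Has11 d k → d k ≡ true → d (suc k) ≡ false
¬Has11⇒upper-zero {d} {k} ¬11 dk with d (suc k) in d1+k
... | false = refl
... | true  = ⊥-elim (¬11 (has11 d1+k dk))

¬Has11⇒lower-zero : ∀ {d k} → ¬ Has11 d k → d (suc k) ≡ true → d k ≡ false
¬Has11⇒lower-zero {d} {k} ¬11 d1+k with d k in dk
... | false = refl
... | true  = ⊥-elim (¬11 (has11 d1+k dk))

digitSum<φ^ : ∀ {d} → No11 d → ∀ n → digitSum d n <φ φ^ (+ n)
digitSum<φ^ {d} no11 n = proj₁ (twoSteps n)
  where
    step : ∀ n → digitSum d n <φ φ^ (+ n) → digitSum d (suc n) <φ φ^ (+ suc n) →
           (digitSum d n ⊕ digit (d n) (φ^ (+ n))) ⊕ digit (d (suc n)) (φ^ (+ suc n)) <φ φ^ (+ suc (suc n))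
    step n Gn< G1+n< with d (suc n) in e₁
    ... | false = subst (_<φ φ^ (+ suc (suc n))) (sym (⊕-identityʳ (digitSum d (suc n))))
                            (<φ-trans G1+n< (<φ-mulφ (Pos-φ^ (suc n))))
    ... | true with d n in e₀
    ...   | false = subst₂ _<φ_ (cong (_⊕ φ^ (+ suc n)) (sym (⊕-identityʳ (digitSum d n))))
                            (sym (trans (φ^-fib n) (⊕-comm (φ^ (+ suc n)) (φ^ (+ n)))))
                            (⊕-monoˡ-<φ (φ^ (+ suc n)) Gn<)
    ...   | true  = ⊥-elim (no11 n (has11 e₁ e₀))
    twoSteps : ∀ n → digitSum d n <φ φ^ (+ n) × digitSum d (suc n) <φ φ^ (+ suc n)
    twoSteps zero    = Pos⇒0<φ (Pos-φ^ 0) ,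
                       ≤φ-<φ-trans (subst (_≤φ oneφ) (sym (⊕-identityˡ _)) (digit-≤φ (d 0) (Pos-φ^ 0)))
                                   (<φ-mulφ (Pos-φ^ 0))
    twoSteps (suc n) = let (Gn< , G1+n<) = twoSteps n in G1+n< , step n Gn< G1+n<

digitSum-injective : ∀ {d d′} → No11 d → No11 d′ →
  ∀ n → digitSum d n ≡ digitSum d′ n → ∀ k → k ℕ.< n → d k ≡ d′ k
digitSum-injective {d} {d′} no11 no11′ (suc n) eq k k<1+n = topDigit (d n) (d′ n) refl refl eq
  where
    lower : d n ≡ d′ n → digitSum d n ≡ digitSum d′ n → d k ≡ d′ k
    lower topₙ eqₙ with ℕP.m<1+n⇒m<n∨m≡n k<1+n
    ... | inj₁ k<n  = digitSum-injective no11 no11′ n eqₙ k k<n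
    ... | inj₂ refl = topₙ
    smaller : ∀ {e e′} → No11 e′ → digitSum e′ n ⊕ zeroφ <φ digitSum e n ⊕ φ^ (+ n)
    smaller {e} {e′} no11ₑ′ =
      subst₂ _<φ_ (sym (⊕-identityʳ (digitSum e′ n))) refl
        (<φ-≤φ-trans (digitSum<φ^ no11ₑ′ n)
          (subst (_≤φ digitSum e n ⊕ φ^ (+ n)) (⊕-identityˡ (φ^ (+ n)))
            (⊕-monoˡ-≤φ (φ^ (+ n)) (0≤φdigitSum e n))))
    topDigit : ∀ b b′ → d n ≡ b → d′ n ≡ b′ →
      digitSum d n ⊕ digit b (φ^ (+ n)) ≡ digitSum d′ n ⊕ digit b′ (φ^ (+ n)) → d k ≡ d′ k
    topDigit true  true  e e′ eq = lower (trans e (sym e′)) (⊕-cancelʳ _ _ (φ^ (+ n)) eq)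
    topDigit false false e e′ eq = lower (trans e (sym e′)) (⊕-cancelʳ _ _ zeroφ eq)
    topDigit true  false e e′ eq =
      ⊥-elim (<φ-irrefl (subst (_<φ digitSum d n ⊕ φ^ (+ n)) (sym eq) (smaller {d} {d′} no11′)))
    topDigit false true  e e′ eq =
      ⊥-elim (<φ-irrefl (subst (_<φ digitSum d′ n ⊕ φ^ (+ n)) eq (smaller {d′} {d} no11)))

-- Integers and Galois conjugation

Pos-antisym : ∀ {u} → Pos u → ¬ Pos (-φ u)
Pos-antisym {u} p q = ¬Pos-zeroφ (subst Pos (⊖-self u) (Pos-⊕ p q))

Pos⇒0<ℤ : ∀ {m} → Pos (m , 0ℤ) → 0ℤ ℤ.< m
Pos⇒0<ℤ {+ zero}   p = ⊥-elim (¬Pos-zeroφ p)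
Pos⇒0<ℤ {+ suc n}  p = ℤ.+<+ (s≤s z≤n)
Pos⇒0<ℤ { -[1+ n ]} p = ⊥-elim (Pos-antisym p (0 , s≤s z≤n))

no-integer-between-0-1 : ∀ m → zeroφ <φ (m , 0ℤ) → (m , 0ℤ) <φ oneφ → ⊥
no-integer-between-0-1 m 0<m m<1 = between (Pos⇒0<ℤ (0<φ⇒Pos 0<m)) (Pos⇒0<ℤ (pos m<1))
  where between : ∀ {m} → 0ℤ ℤ.< m → ¬ (0ℤ ℤ.< 1ℤ + - m)
        between {+ zero}        (ℤ.+<+ ()) _
        between {+ suc zero}    _ (ℤ.+<+ ())
        between {+ suc (suc k)} _ ()

1≤φ-ℕ→Zφ : ∀ N → 1 ℕ.≤ N → oneφ ≤φ ℕ→Zφ N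
1≤φ-ℕ→Zφ (suc zero)    _ = inj₁ refl
1≤φ-ℕ→Zφ (suc (suc n)) _ = inj₂ (mk<φ (0 , s≤s z≤n))

-- Galois conjugation a + bφ ↦ a + bψ, where ψ = 1 − φ = −φ⁻¹ is the other root of x² = x + 1.
conj : Zφ → Zφ
conj (a , b) = (a + b , - b)

mulψ : Zφ → Zφ
mulψ (a , b) = (a - b , - a)

conj-⊕ : ∀ u v → conj (u ⊕ v) ≡ conj u ⊕ conj v
conj-⊕ (a , b) (c , d) = cong₂ _,_ (h a b c d) (ℤP.neg-distrib-+ b d)
  where h : ∀ a b c d → (a + c) + (b + d) ≡ (a + b) + (c + d)
        h = solve-∀

conj-mulφ : ∀ u → conj (mulφ u) ≡ mulψ (conj u)
conj-mulφ (a , b) = cong₂ _,_ (h a b) refl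
  where h : ∀ a b → b + (a + b) ≡ (a + b) - - b
        h = solve-∀

conj-iter-mulφ : ∀ k u → conj (iter mulφ k u) ≡ iter mulψ k (conj u)
conj-iter-mulφ zero    u = refl
conj-iter-mulφ (suc k) u = trans (conj-mulφ (iter mulφ k u)) (cong mulψ (conj-iter-mulφ k u))

⊕-conj-integer : ∀ u → ∃ λ t → u ⊕ conj u ≡ (t , 0ℤ)
⊕-conj-integer (a , b) = a + (a + b) , cong₂ _,_ refl (ℤP.+-inverseʳ b)

mulψ-antimono-<φ : ∀ {u v} → u <φ v → mulψ v <φ mulψ u
mulψ-antimono-<φ {a , b} {c , d} (mk<φ p) = mk<φ (subst Pos (cong₂ _,_ (h a b c d) (h′ a c)) (Pos-divφ p))
  where h : ∀ a b c d → (d + - b) - (c + - a) ≡ (a - b) + - (c - d)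
        h = solve-∀
        h′ : ∀ a c → c + - a ≡ - a + - - c
        h′ = solve-∀

Between : Zφ → Zφ → Zφ → Set
Between a b s = a <φ s × s <φ b

⊕-Between : ∀ c {a b s} → Between a b s → Between (c ⊕ a) (c ⊕ b) (c ⊕ s)
⊕-Between c (a<s , s<b) = ⊕-monoʳ-<φ c a<s , ⊕-monoʳ-<φ c s<b

mulψ-Between : ∀ {a b s} → Between a b s → Between (mulψ b) (mulψ a) (mulψ s)
mulψ-Between (a<s , s<b) = mulψ-antimono-<φ s<b , mulψ-antimono-<φ a<s

ConjRange : Bool → Zφ → Set
ConjRange false = Between (-φ oneφ) φ⁻¹
ConjRange true  = Between φ⁻¹ φ

ConjRange⇒Between : ∀ b {s} → ConjRange b s → Between (-φ oneφ) φ s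
ConjRange⇒Between false (-1<s , s<φ⁻¹) = -1<s , <φ-trans s<φ⁻¹ (mk<φ (0 , s≤s z≤n))
ConjRange⇒Between true  (φ⁻¹<s , s<φ)  = <φ-trans (mk<φ (0 , s≤s z≤n)) φ⁻¹<s , s<φ

conj-leading-digit : ∀ b → ConjRange b (conj (zeroφ ⊕ digit b oneφ))
conj-leading-digit false = mk<φ (0 , s≤s z≤n) , mk<φ (1 , s≤s z≤n)
conj-leading-digit true  = mk<φ (2 , s≤s z≤n) , mk<φ (1 , s≤s z≤n)

conj-range-step : ∀ b b′ {t} → (b ≡ true → b′ ≡ false) → ConjRange b′ t →
                  ConjRange b (conj (digit b oneφ) ⊕ mulψ t)
conj-range-step false b′ _ t-range = ⊕-Between zeroφ (mulψ-Between (ConjRange⇒Between b′ t-range))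
conj-range-step true  b′ b′≡false t-range with b′≡false refl
... | refl = ⊕-Between oneφ (mulψ-Between t-range)

conj-digitSum-range : ∀ {e} → No11 e → ∀ n → ConjRange (e 0) (conj (digitSum e (suc n)))
conj-digitSum-range {e} no11 zero    = conj-leading-digit (e 0)
conj-digitSum-range {e} no11 (suc n) =
  subst (ConjRange (e 0)) (sym conj-expansion)
    (conj-range-step (e 0) (e 1) (¬Has11⇒upper-zero (no11 0))
      (conj-digitSum-range {λ k → e (suc k)} (λ k (has11 u l) → no11 (suc k) (has11 u l)) n))
  where
    conj-expansion : conj (digitSum e (suc (suc n)))
                   ≡ conj (digit (e 0) oneφ) ⊕ mulψ (conj (digitSum (λ k → e (suc k)) (suc n)))
    conj-expansion = trans (cong conj (digitSum-suc e (suc n)))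
                       (trans (conj-⊕ (digit (e 0) oneφ) (mulφ tail))
                              (cong (conj (digit (e 0) oneφ) ⊕_) (conj-mulφ tail)))
      where tail : Zφ
            tail = digitSum (λ k → e (suc k)) (suc n)

mulψ-even-Between : ∀ w {s} → Between zeroφ φ s → Between zeroφ φ (iter mulψ (w ℕ.+ w) s)
mulψ-even-Between zero    range = range
mulψ-even-Between (suc w) {s} range =
  subst (λ k → Between zeroφ φ (iter mulψ k s)) (cong suc (sym (ℕP.+-suc w w)))
    (widen (mulψ-Between (mulψ-Between (mulψ-even-Between w range))))
  where widen : ∀ {u} → Between zeroφ φ⁻¹ u → Between zeroφ φ u
        widen (0<u , u<φ⁻¹) = 0<u , <φ-trans u<φ⁻¹ (mk<φ (0 , s≤s z≤n))

mulψ-odd-Between : ∀ w {s} → Between zeroφ φ s → Between (-φ φ⁻²) zeroφ (iter mulψ (3 ℕ.+ (w ℕ.+ w)) s)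
mulψ-odd-Between w range = mulψ-Between (mulψ-Between (mulψ-Between (mulψ-even-Between w range)))

unit-split : ∀ y s → oneφ ⊖ (y ⊖ s) ≡ (φ⁻¹ ⊖ y) ⊕ (s ⊖ (-φ φ⁻²))
unit-split (a , b) (c , d) = cong₂ _,_ (h a c) (h′ b d)
  where h : ∀ a c → 1ℤ + - (a + - c) ≡ (-1ℤ + - a) + (c + + 2)
        h = solve-∀
        h′ : ∀ b d → 0ℤ + - (b + - d) ≡ (1ℤ + - b) + (d + -1ℤ)
        h′ = solve-∀

-- y − conj x = N − (x + conj x) would be an integer strictly between 0 and φ⁻¹ + φ⁻² = 1.
no-integer-split : ∀ {x y N} → y ⊕ x ≡ (N , 0ℤ) → Between (-φ φ⁻²) zeroφ (conj x) →
                   zeroφ ≤φ y → y <φ φ⁻¹ → ⊥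
no-integer-split {x} {y} {N} y+x≡N (-φ⁻²<σx , σx<0) 0≤y y<φ⁻¹ =
  no-integer-between-0-1 (N + - t) (subst (zeroφ <φ_) gap≡ (Pos⇒0<φ (pos (<φ-≤φ-trans σx<0 0≤y))))
    (mk<φ (subst (λ g → Pos (oneφ ⊖ g)) gap≡
            (subst Pos (sym (unit-split y (conj x))) (Pos-⊕ (pos y<φ⁻¹) (pos -φ⁻²<σx)))))
  where
    t : ℤ
    t = proj₁ (⊕-conj-integer x)
    gap≡ : y ⊖ conj x ≡ (N + - t , 0ℤ)
    gap≡ = trans (sym (⊕-⊖-cancelʳ y (conj x) x))
                 (cong₂ _⊖_ y+x≡N (trans (⊕-comm (conj x) x) (proj₂ (⊕-conj-integer x))))

-- Carrying

digitSum-window : ∀ {d d′} Q w n → w ℕ.+ Q ℕ.≤ n →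
  (∀ k → k ℕ.< Q ⊎ w ℕ.+ Q ℕ.≤ k → d k ≡ d′ k) →
  digitSum (λ i → d (i ℕ.+ Q)) w ≡ digitSum (λ i → d′ (i ℕ.+ Q)) w →
  digitSum d n ≡ digitSum d′ n
digitSum-window {d} {d′} Q w n w+Q≤n outside window = begin
  digitSum d n
    ≡⟨ cong (digitSum d) (sym r+w+Q≡n) ⟩
  digitSum d (r ℕ.+ (w ℕ.+ Q))
    ≡⟨ split d ⟩
  (digitSum d Q ⊕ iter mulφ Q (digitSum (λ i → d (i ℕ.+ Q)) w)) ⊕ iter mulφ (w ℕ.+ Q) (tail d)
    ≡⟨ cong₂ (λ u v → (u ⊕ iter mulφ Q v) ⊕ iter mulφ (w ℕ.+ Q) (tail d))
             (digitSum-cong Q (λ k k<Q → outside k (inj₁ k<Q))) window ⟩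
  (digitSum d′ Q ⊕ iter mulφ Q (digitSum (λ i → d′ (i ℕ.+ Q)) w)) ⊕ iter mulφ (w ℕ.+ Q) (tail d)
    ≡⟨ cong (λ v → (digitSum d′ Q ⊕ iter mulφ Q (digitSum (λ i → d′ (i ℕ.+ Q)) w)) ⊕ iter mulφ (w ℕ.+ Q) v)
            (digitSum-cong r (λ k _ → outside (k ℕ.+ (w ℕ.+ Q)) (inj₂ (ℕP.m≤n+m _ k)))) ⟩
  (digitSum d′ Q ⊕ iter mulφ Q (digitSum (λ i → d′ (i ℕ.+ Q)) w)) ⊕ iter mulφ (w ℕ.+ Q) (tail d′)
    ≡⟨ sym (split d′) ⟩
  digitSum d′ (r ℕ.+ (w ℕ.+ Q))
    ≡⟨ cong (digitSum d′) r+w+Q≡n ⟩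
  digitSum d′ n
    ∎
  where
    open ≡-Reasoning
    r : ℕ
    r = proj₁ (ℕP.m≤n⇒∃[o]m+o≡n w+Q≤n)
    r+w+Q≡n : r ℕ.+ (w ℕ.+ Q) ≡ n
    r+w+Q≡n = trans (ℕP.+-comm r _) (proj₂ (ℕP.m≤n⇒∃[o]m+o≡n w+Q≤n))
    tail : (ℕ → Bool) → Zφ
    tail e = digitSum (λ k → e (k ℕ.+ (w ℕ.+ Q))) r
    split : ∀ e → digitSum e (r ℕ.+ (w ℕ.+ Q))
                ≡ (digitSum e Q ⊕ iter mulφ Q (digitSum (λ i → e (i ℕ.+ Q)) w)) ⊕ iter mulφ (w ℕ.+ Q) (tail e)
    split e = trans (digitSum-+ e r (w ℕ.+ Q)) (cong (_⊕ iter mulφ (w ℕ.+ Q) (tail e)) (digitSum-+ e w Q))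

ZeroFrom : ℕ → (ℕ → Bool) → Set
ZeroFrom n d = ∀ k → n ℕ.≤ k → d k ≡ false

No11Except : ℕ → (ℕ → Bool) → Set
No11Except j d = ∀ k → k ≢ j → ¬ Has11 d k

-- Abstract: unfolding the ≟ tests makes unification with updated sequences very slow.
abstract
  _[_]≔_ : (ℕ → Bool) → ℕ → Bool → ℕ → Bool
  (d [ j ]≔ b) k with k ℕ.≟ j
  ... | yes _ = b
  ... | no  _ = d k

  []≔-same : ∀ d j b → (d [ j ]≔ b) j ≡ b
  []≔-same d j b with j ℕ.≟ j
  ... | yes _   = refl
  ... | no  j≢j = ⊥-elim (j≢j refl)

  []≔-other : ∀ d {j k} b → k ≢ j → (d [ j ]≔ b) k ≡ d k
  []≔-other d {j} {k} b k≢j with k ℕ.≟ j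
  ... | yes k≡j = ⊥-elim (k≢j k≡j)
  ... | no  _   = refl

  Has11-[]≔false : ∀ d j k → Has11 (d [ j ]≔ false) k → Has11 d k × k ≢ j × suc k ≢ j
  Has11-[]≔false d j k (has11 h₁ h₀) = has11 (unchanged h₁) (unchanged h₀) , untouched h₀ , untouched h₁
    where
      untouched : ∀ {i} → (d [ j ]≔ false) i ≡ true → i ≢ j
      untouched h refl with () ← trans (sym ([]≔-same d j false)) h
      unchanged : ∀ {i} → (d [ j ]≔ false) i ≡ true → d i ≡ true
      unchanged h = trans (sym ([]≔-other d false (untouched h))) h

  Has11-[]≔true : ∀ d j k → Has11 (d [ j ]≔ true) k →
                  Has11 d k ⊎ (k ≡ j × d (suc k) ≡ true) ⊎ (suc k ≡ j × d k ≡ true)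
  Has11-[]≔true d j k (has11 h₁ h₀) with k ℕ.≟ j
  ... | yes refl = inj₂ (inj₁ (refl , trans (sym ([]≔-other d true ℕP.1+n≢n)) h₁))
  ... | no  _ with suc k ℕ.≟ j
  ...   | yes 1+k≡j = inj₂ (inj₂ (1+k≡j , h₀))
  ...   | no  _     = inj₁ (has11 h₁ h₀)

put : ℕ → Bool → Bool → Bool → (ℕ → Bool) → ℕ → Bool
put Q a b c d = ((d [ Q ]≔ a) [ suc Q ]≔ b) [ 2 ℕ.+ Q ]≔ c

carry uncarry : ℕ → (ℕ → Bool) → ℕ → Bool
carry   Q = put Q false false true
uncarry Q = put Q true  true  false

outside-window : ∀ {Q k} → k ℕ.< Q ⊎ 3 ℕ.+ Q ℕ.≤ k → ∀ i → i ℕ.< 3 → k ≢ i ℕ.+ Q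
outside-window {Q} (inj₁ k<Q)   i _   = ℕP.<⇒≢ (ℕP.<-≤-trans k<Q (ℕP.m≤n+m Q i))
outside-window {Q} (inj₂ 3+Q≤k) i i<3 k≡i+Q =
  ℕP.<⇒≢ (ℕP.<-≤-trans (ℕP.+-monoˡ-< Q i<3) 3+Q≤k) (sym k≡i+Q)

put-outside : ∀ Q a b c d k → k ℕ.< Q ⊎ 3 ℕ.+ Q ℕ.≤ k → put Q a b c d k ≡ d k
put-outside Q a b c d k outside =
  trans ([]≔-other ((d [ Q ]≔ a) [ suc Q ]≔ b) {2 ℕ.+ Q} {k} c (k≢ 2 (s≤s (s≤s (s≤s z≤n)))))
        (trans ([]≔-other (d [ Q ]≔ a) {suc Q} {k} b (k≢ 1 (s≤s (s≤s z≤n)))) ([]≔-other d {Q} {k} a (k≢ 0 (s≤s z≤n))))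
  where k≢ : ∀ i → i ℕ.< 3 → k ≢ i ℕ.+ Q
        k≢ = outside-window outside

put-0 : ∀ Q a b c d → put Q a b c d Q ≡ a
put-0 Q a b c d =
  trans ([]≔-other ((d [ Q ]≔ a) [ suc Q ]≔ b) {2 ℕ.+ Q} {Q} c (ℕP.m≢1+n+m Q))
        (trans ([]≔-other (d [ Q ]≔ a) {suc Q} {Q} b (ℕP.m≢1+n+m Q)) ([]≔-same d Q a))

put-1 : ∀ Q a b c d → put Q a b c d (suc Q) ≡ b
put-1 Q a b c d =
  trans ([]≔-other ((d [ Q ]≔ a) [ suc Q ]≔ b) {2 ℕ.+ Q} {suc Q} c (ℕP.m≢1+n+m (suc Q) {0}))
        ([]≔-same (d [ Q ]≔ a) (suc Q) b)

put-2 : ∀ Q a b c d → put Q a b c d (2 ℕ.+ Q) ≡ c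
put-2 Q a b c d = []≔-same ((d [ Q ]≔ a) [ suc Q ]≔ b) (2 ℕ.+ Q) c

φ²≡φ+1 : ∀ {d d′ : ℕ → Bool} {Q} → d Q ≡ false → d (suc Q) ≡ false → d (2 ℕ.+ Q) ≡ true →
         d′ Q ≡ true → d′ (suc Q) ≡ true → d′ (2 ℕ.+ Q) ≡ false →
         digitSum (λ i → d (i ℕ.+ Q)) 3 ≡ digitSum (λ i → d′ (i ℕ.+ Q)) 3
φ²≡φ+1 p q r p′ q′ r′ rewrite p | q | r | p′ | q′ | r′ = refl

digitSum-carry : ∀ Q n d → 3 ℕ.+ Q ℕ.≤ n → d Q ≡ true → d (suc Q) ≡ true → d (2 ℕ.+ Q) ≡ false →
                 digitSum (carry Q d) n ≡ digitSum d n
digitSum-carry Q n d 3+Q≤n p q r =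
  digitSum-window Q 3 n 3+Q≤n (put-outside Q false false true d)
    (φ²≡φ+1 {carry Q d} {d} (put-0 Q false false true d) (put-1 Q false false true d)
                            (put-2 Q false false true d) p q r)

digitSum-uncarry : ∀ Q n d → 3 ℕ.+ Q ℕ.≤ n → d Q ≡ false → d (suc Q) ≡ false → d (2 ℕ.+ Q) ≡ true →
                   digitSum (uncarry Q d) n ≡ digitSum d n
digitSum-uncarry Q n d 3+Q≤n p q r =
  digitSum-window Q 3 n 3+Q≤n (put-outside Q true true false d)
    (sym (φ²≡φ+1 {d} {uncarry Q d} p q r (put-0 Q true true false d) (put-1 Q true true false d)
                                         (put-2 Q true true false d)))

carry-No11Except : ∀ {Q d} → No11Except Q d → No11Except (2 ℕ.+ Q) (carry Q d)
carry-No11Except {Q} {d} no11 k k≢2+Q h with Has11-[]≔true ((d [ Q ]≔ false) [ suc Q ]≔ false) (2 ℕ.+ Q) k h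
... | inj₂ (inj₁ (k≡2+Q , _)) = k≢2+Q k≡2+Q
... | inj₂ (inj₂ (refl , h₀)) with () ← trans (sym ([]≔-same (d [ Q ]≔ false) (suc Q) false)) h₀
... | inj₁ h′ with Has11-[]≔false (d [ Q ]≔ false) (suc Q) k h′
...   | h″ , _ , _ with Has11-[]≔false d Q k h″
...     | h‴ , k≢Q , _ = no11 k k≢Q h‴

uncarry-No11Except : ∀ {Q d} → (∀ k → suc k ≡ Q → d k ≡ false) →
                     No11Except (2 ℕ.+ Q) d → No11Except Q (uncarry Q d)
uncarry-No11Except {Q} {d} below no11 k k≢Q h with Has11-[]≔false ((d [ Q ]≔ true) [ suc Q ]≔ true) (2 ℕ.+ Q) k h
... | h′ , k≢2+Q , 1+k≢2+Q with Has11-[]≔true (d [ Q ]≔ true) (suc Q) k h′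
...   | inj₂ (inj₁ (refl , _)) = 1+k≢2+Q refl
...   | inj₂ (inj₂ (refl , _)) = k≢Q refl
...   | inj₁ h″ with Has11-[]≔true d Q k h″
...     | inj₁ h‴                  = no11 k k≢2+Q h‴
...     | inj₂ (inj₁ (k≡Q , _))    = k≢Q k≡Q
...     | inj₂ (inj₂ (1+k≡Q , dk)) with () ← trans (sym (below k 1+k≡Q)) dk

-- The theorem for digit sequences indexed by ℕ

first-true : ∀ (f : ℕ → Bool) n → (∀ i → i ℕ.< n → f i ≡ false) ⊎
             ∃ λ t → t ℕ.< n × f t ≡ true × (∀ i → i ℕ.< t → f i ≡ false)
first-true f zero = inj₁ (λ i ())
first-true f (suc n) with f 0 in f0 | first-true (λ i → f (suc i)) n
... | true  | _ = inj₂ (0 , s≤s z≤n , f0 , λ i ())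
... | false | inj₁ none = inj₁ λ where
  zero    _         → f0
  (suc i) (s≤s i<n) → none i i<n
... | false | inj₂ (t , t<n , ft , before) = inj₂ (suc t , s≤s t<n , ft , λ where
  zero    _         → f0
  (suc i) (s≤s i<t) → before i i<t)

data Parity : ℕ → Set where
  even : ∀ s → Parity (s ℕ.+ s)
  odd  : ∀ s → Parity (suc (s ℕ.+ s))

parity : ∀ n → Parity n
parity zero = even 0
parity (suc n) with parity n
... | even s = odd s
... | odd  s = subst Parity (cong suc (ℕP.+-suc s s)) (even (suc s))

ZeroFrom⇒< : ∀ {S d k} → ZeroFrom S d → d k ≡ true → k ℕ.< S
ZeroFrom⇒< {S} {d} {k} zero-from dk with S ℕ.≤? k
... | yes S≤k with () ← trans (sym dk) (zero-from k S≤k)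
... | no  S≰k = ℕP.≰⇒> S≰k

No11Except⇒No11 : ∀ {j d} → No11Except j d → d (suc j) ≡ false → No11 d
No11Except⇒No11 {j} no11 d1+j≡false k (has11 d1+k dk) with k ℕ.≟ j
... | yes refl with () ← trans (sym d1+k) d1+j≡false
... | no  k≢j = no11 k k≢j (has11 d1+k dk)

carry-agrees : ∀ {Q} {d D : ℕ → Bool} → (∀ k → k ℕ.< 2 ℕ.+ Q → D k ≡ carry Q d k) →
               (∀ k → k ℕ.< Q → D k ≡ d k) × D Q ≡ false × D (suc Q) ≡ false
carry-agrees {Q} {d} D≗carry =
  (λ k k<Q → trans (D≗carry k (ℕP.<-trans k<Q (s≤s (ℕP.n≤1+n Q)))) (put-outside Q false false true d k (inj₁ k<Q))) ,
  trans (D≗carry Q (s≤s (ℕP.n≤1+n Q))) (put-0 Q false false true d) ,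
  trans (D≗carry (suc Q) ℕP.≤-refl) (put-1 Q false false true d)

-- Carry the "11" at Q upwards (the digits 1 1 0 at Q, Q + 1, Q + 2 become 0 0 1) until no "11" is left,
-- which happens within S steps; by uniqueness the result is D.
Bergman-agrees-below-11 : ∀ {S n} → S ℕ.< n → ∀ f Q d → S ℕ.≤ f ℕ.+ Q → ZeroFrom S d →
  d Q ≡ true → d (suc Q) ≡ true → No11Except Q d →
  ∀ D → No11 D → digitSum D n ≡ digitSum d n →
  (∀ k → k ℕ.< Q → D k ≡ d k) × D Q ≡ false × D (suc Q) ≡ false
Bergman-agrees-below-11 S<n zero Q d S≤Q zero-from dQ _ _ _ _ _ with () ← trans (sym dQ) (zero-from Q S≤Q)
Bergman-agrees-below-11 {S} {n} S<n (suc f) Q d S≤1+f+Q zero-from dQ d1+Q no11 D no11ᴰ D≡d =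
  carry-agrees {Q} {d} {D} (D≗carry (d (3 ℕ.+ Q)) refl)
  where
    2+Q<n : 2 ℕ.+ Q ℕ.< n
    2+Q<n = ℕP.<-≤-trans (s≤s (ZeroFrom⇒< zero-from d1+Q)) S<n
    D≡carry : digitSum D n ≡ digitSum (carry Q d) n
    D≡carry = trans D≡d (sym (digitSum-carry Q n d 2+Q<n dQ d1+Q (¬Has11⇒upper-zero (no11 (suc Q) ℕP.1+n≢n) d1+Q)))
    carry-3+Q : carry Q d (3 ℕ.+ Q) ≡ d (3 ℕ.+ Q)
    carry-3+Q = put-outside Q false false true d (3 ℕ.+ Q) (inj₂ ℕP.≤-refl)
    D≗carry : ∀ b → d (3 ℕ.+ Q) ≡ b → ∀ k → k ℕ.< 2 ℕ.+ Q → D k ≡ carry Q d k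
    D≗carry false d3+Q k k<2+Q = digitSum-injective no11ᴰ no11ᶜ n D≡carry k (ℕP.<-trans k<2+Q 2+Q<n)
      where
        no11ᶜ : No11 (carry Q d)
        no11ᶜ = No11Except⇒No11 (carry-No11Except no11) (trans carry-3+Q d3+Q)
    D≗carry true d3+Q = proj₁ (Bergman-agrees-below-11 S<n f (2 ℕ.+ Q) (carry Q d) S≤f+2+Q zero-fromᶜ
      (put-2 Q false false true d) (trans carry-3+Q d3+Q) (carry-No11Except no11) D no11ᴰ D≡carry)
      where
        3+Q<S : 3 ℕ.+ Q ℕ.< S
        3+Q<S = ZeroFrom⇒< zero-from d3+Q
        S≤f+2+Q : S ℕ.≤ f ℕ.+ (2 ℕ.+ Q)
        S≤f+2+Q = ℕP.≤-trans S≤1+f+Q (ℕP.≤-trans (ℕP.n≤1+n _) (ℕP.≤-reflexive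
                    (sym (trans (ℕP.+-suc f (suc Q)) (cong suc (ℕP.+-suc f Q))))))
        zero-fromᶜ : ZeroFrom S (carry Q d)
        zero-fromᶜ k S≤k = trans (put-outside Q false false true d k (inj₂ (ℕP.≤-trans (ℕP.<⇒≤ 3+Q<S) S≤k)))
                                 (zero-from k S≤k)

IsSpecialAt : ℕ → (ℕ → Bool) → Set
IsSpecialAt P d = d P ≡ true × d (suc P) ≡ true × No11Except P d

Bergman-zeros-around-special : ∀ {m S n E D} → IsSpecialAt (suc m) E → ZeroFrom S E → S ℕ.< n →
  No11 D → digitSum D n ≡ digitSum E n → D m ≡ false × D (suc m) ≡ false × D (2 ℕ.+ m) ≡ false
Bergman-zeros-around-special {m} {S} {n} {E} {D} (E1+m , E2+m , no11ᴱ) zero-from S<n no11ᴰ D≡E =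
  let (D≗E , D1+m , D2+m) = Bergman-agrees-below-11 S<n S (suc m) E (ℕP.m≤m+n S _) zero-from E1+m E2+m no11ᴱ D no11ᴰ D≡E
  in trans (D≗E m ℕP.≤-refl) (¬Has11⇒lower-zero (no11ᴱ m (ℕP.1+n≢n ∘ sym)) E1+m) , D1+m , D2+m

IsolatedOne : ℕ → ℕ → (ℕ → Bool) → Set
IsolatedOne m q d = d q ≡ true × (∀ k → m ℕ.≤ k → k ℕ.< q → d k ≡ false) × No11Except q d

uncarry-step : ∀ {m Q n d} → m ℕ.< Q → IsolatedOne m (2 ℕ.+ Q) d → ZeroFrom n d →
  IsolatedOne m Q (uncarry Q d) × uncarry Q d (suc Q) ≡ true ×
  ZeroFrom n (uncarry Q d) × digitSum (uncarry Q d) n ≡ digitSum d n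
uncarry-step {m} {Q} {n} {d} m<Q (d2+Q , zeros , no11) zero-from =
  (put-0 Q true true false d , zerosᵘ , uncarry-No11Except below no11) ,
  put-1 Q true true false d ,
  zero-fromᵘ ,
  digitSum-uncarry Q n d 2+Q<n (zeros Q (ℕP.<⇒≤ m<Q) (ℕP.m<n+m Q {2} (s≤s z≤n)))
                   (zeros (suc Q) (ℕP.m≤n⇒m≤1+n (ℕP.<⇒≤ m<Q)) (ℕP.m<n+m (suc Q) {1} (s≤s z≤n))) d2+Q
  where
    2+Q<n : 2 ℕ.+ Q ℕ.< n
    2+Q<n = ZeroFrom⇒< zero-from d2+Q
    zerosᵘ : ∀ k → m ℕ.≤ k → k ℕ.< Q → uncarry Q d k ≡ false
    zerosᵘ k m≤k k<Q = trans (put-outside Q true true false d k (inj₁ k<Q))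
                             (zeros k m≤k (ℕP.<-trans k<Q (ℕP.m<n+m Q {2} (s≤s z≤n))))
    below : ∀ k → suc k ≡ Q → d k ≡ false
    below k refl = zeros k (ℕP.≤-pred m<Q) (ℕP.m<n+m k {3} (s≤s z≤n))
    zero-fromᵘ : ZeroFrom n (uncarry Q d)
    zero-fromᵘ k n≤k = trans (put-outside Q true true false d k (inj₂ (ℕP.≤-trans 2+Q<n n≤k))) (zero-from k n≤k)

-- Each uncarry (0 0 1 at Q, Q + 1, Q + 2 become 1 1 0) moves the lowest 1 down by two places, until it
-- becomes the "11" at 1 + m.
special-by-uncarries : ∀ {m n} s d → IsolatedOne m (3 ℕ.+ (s ℕ.+ s) ℕ.+ m) d → ZeroFrom n d →
  ∃ λ E → IsSpecialAt (suc m) E × ZeroFrom n E × digitSum E n ≡ digitSum d n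
special-by-uncarries {m} {n} zero d iso zero-from =
  let ((u1+m , _ , no11ᵘ) , u2+m , zero-fromᵘ , sumᵘ) = uncarry-step {m} {suc m} {n} {d} ℕP.≤-refl iso zero-from
  in uncarry (suc m) d , (u1+m , u2+m , no11ᵘ) , zero-fromᵘ , sumᵘ
special-by-uncarries {m} {n} (suc s) d iso zero-from =
  let (isoᵘ , _ , zero-fromᵘ , sumᵘ) = uncarry-step {m} {Q} {n} {d} (s≤s (ℕP.m≤n+m m _)) iso zero-from
      (E , special , zero-fromᴱ , sumᴱ) =
        special-by-uncarries s (uncarry Q d) (subst (λ q → IsolatedOne m q (uncarry Q d)) Q≡ isoᵘ) zero-fromᵘ
  in E , special , zero-fromᴱ , trans sumᴱ sumᵘ
  where
    Q : ℕ
    Q = suc (suc s ℕ.+ suc s ℕ.+ m)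
    Q≡ : Q ≡ 3 ℕ.+ (s ℕ.+ s) ℕ.+ m
    Q≡ = cong (λ t → suc (suc (t ℕ.+ m))) (ℕP.+-suc s s)

fractional-part-Between : ∀ {D} → No11 D → ∀ m →
  zeroφ ≤φ iter divφ (suc m) (digitSum D m) × iter divφ (suc m) (digitSum D m) <φ φ⁻¹
fractional-part-Between {D} no11 m =
  subst (_≤φ iter divφ (suc m) (digitSum D m)) (iter-fix divφ refl (suc m))
        (iter-divφ-mono-≤φ (suc m) (0≤φdigitSum D m)) ,
  subst (iter divφ (suc m) (digitSum D m) <φ_) (cong divφ (iter-divφ-mulφ m oneφ))
        (iter-divφ-mono-<φ (suc m) (digitSum<φ^ no11 m))

offsets⇒range : ∀ {m g} {d : ℕ → Bool} → (∀ i → i ℕ.< g → d (i ℕ.+ m) ≡ false) →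
                ∀ k → m ℕ.≤ k → k ℕ.< g ℕ.+ m → d k ≡ false
offsets⇒range {m} {g} {d} gap k m≤k k<g+m =
  subst (λ k → d k ≡ false) k∸m+m≡k
    (gap (k ℕ.∸ m) (ℕP.+-cancelʳ-< m (k ℕ.∸ m) g (subst (ℕ._< g ℕ.+ m) (sym k∸m+m≡k) k<g+m)))
  where k∸m+m≡k : k ℕ.∸ m ℕ.+ m ≡ k
        k∸m+m≡k = ℕP.m∸n+n≡m m≤k

gap-offsets : ∀ {m g} {d : ℕ → Bool} → d m ≡ false → d (suc m) ≡ false → d (2 ℕ.+ m) ≡ false →
              (∀ t → t ℕ.< g → d (3 ℕ.+ t ℕ.+ m) ≡ false) → ∀ i → i ℕ.< 3 ℕ.+ g → d (i ℕ.+ m) ≡ false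
gap-offsets d0 d1 d2 above zero                _ = d0
gap-offsets d0 d1 d2 above (suc zero)          _ = d1
gap-offsets d0 d1 d2 above (suc (suc zero))    _ = d2
gap-offsets d0 d1 d2 above (suc (suc (suc t))) (s≤s (s≤s (s≤s t<g))) = above t t<g

-- The lowest 1 above the point 1 + m sits at the odd distance j = 3 + 2s from it.
Bergman-no-odd-gap : ∀ {m n N D} s → No11 D → ZeroFrom n D →
  (∀ i → i ℕ.< 4 ℕ.+ (s ℕ.+ s) → D (i ℕ.+ m) ≡ false) → D (4 ℕ.+ (s ℕ.+ s) ℕ.+ m) ≡ true →
  digitSum D n ≡ iter mulφ (suc m) (ℕ→Zφ N) → ⊥
Bergman-no-odd-gap {m} {n} {N} {D} s no11 zero-from gap DQ D≡N =
  no-integer-split y+x≡N (subst (Between (-φ φ⁻²) zeroφ) (sym (conj-iter-mulφ j Z)) (mulψ-odd-Between s σZ-Between))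
    (proj₁ (fractional-part-Between no11 m)) (proj₂ (fractional-part-Between no11 m))
  where
    j Q : ℕ
    j = 3 ℕ.+ (s ℕ.+ s)
    Q = 4 ℕ.+ (s ℕ.+ s) ℕ.+ m
    o : ℕ
    o = proj₁ (ℕP.m≤n⇒∃[o]m+o≡n (ZeroFrom⇒< zero-from DQ))
    n≡ : suc o ℕ.+ Q ≡ n
    n≡ = trans (cong suc (ℕP.+-comm o Q)) (proj₂ (ℕP.m≤n⇒∃[o]m+o≡n (ZeroFrom⇒< zero-from DQ)))
    z : ℕ → Bool
    z k = D (k ℕ.+ Q)
    Z : Zφ
    Z = digitSum z (suc o)
    σZ-Between : Between zeroφ φ (conj Z)
    σZ-Between = widen (subst (λ b → ConjRange b (conj Z)) DQ
                          (conj-digitSum-range {z} (λ k (has11 u l) → no11 (k ℕ.+ Q) (has11 u l)) o))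
      where widen : ConjRange true (conj Z) → Between zeroφ φ (conj Z)
            widen (φ⁻¹<σZ , σZ<φ) = <φ-trans (mk<φ (1 , s≤s z≤n)) φ⁻¹<σZ , σZ<φ
    split : digitSum D n ≡ digitSum D m ⊕ iter mulφ (suc m) (iter mulφ j Z)
    split = begin
      digitSum D n                             ≡⟨ cong (digitSum D) (sym n≡) ⟩
      digitSum D (suc o ℕ.+ Q)                 ≡⟨ digitSum-+ D (suc o) Q ⟩
      digitSum D Q ⊕ iter mulφ Q Z             ≡⟨ cong₂ _⊕_ (digitSum-gap D (4 ℕ.+ (s ℕ.+ s)) m gap)
                                                           (trans (cong (λ k → iter mulφ k Z) (cong suc (ℕP.+-comm j m)))
                                                                  (iter-+ mulφ (suc m) j Z)) ⟩
      digitSum D m ⊕ iter mulφ (suc m) (iter mulφ j Z) ∎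
      where open ≡-Reasoning
    y+x≡N : iter divφ (suc m) (digitSum D m) ⊕ iter mulφ j Z ≡ ℕ→Zφ N
    y+x≡N = unscale (suc m) (digitSum D m) (iter mulφ j Z) (ℕ→Zφ N) (trans (sym split) D≡N)

Bergman-nonzero-above : ∀ {m n N D} → No11 D → 1 ℕ.≤ N → m ℕ.≤ n →
  (∀ i → i ℕ.< n ℕ.∸ m → D (i ℕ.+ m) ≡ false) → digitSum D n ≡ iter mulφ (suc m) (ℕ→Zφ N) → ⊥
Bergman-nonzero-above {m} {n} {N} {D} no11 1≤N m≤n gap D≡N =
  <φ-irrefl (<φ-trans N<φ⁻¹ (<φ-≤φ-trans (mk<φ (2 , s≤s z≤n)) (1≤φ-ℕ→Zφ N 1≤N)))
  where
    Dm≡N : digitSum D m ⊕ iter mulφ (suc m) zeroφ ≡ iter mulφ (suc m) (ℕ→Zφ N)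
    Dm≡N = begin
      digitSum D m ⊕ iter mulφ (suc m) zeroφ ≡⟨ cong (digitSum D m ⊕_) (iter-fix mulφ refl (suc m)) ⟩
      digitSum D m ⊕ zeroφ                    ≡⟨ ⊕-identityʳ (digitSum D m) ⟩
      digitSum D m                            ≡⟨ sym (digitSum-gap D (n ℕ.∸ m) m gap) ⟩
      digitSum D (n ℕ.∸ m ℕ.+ m)              ≡⟨ cong (digitSum D) (ℕP.m∸n+n≡m m≤n) ⟩
      digitSum D n                            ≡⟨ D≡N ⟩
      iter mulφ (suc m) (ℕ→Zφ N)              ∎
      where open ≡-Reasoning
    N<φ⁻¹ : ℕ→Zφ N <φ φ⁻¹
    N<φ⁻¹ = subst (_<φ φ⁻¹) (trans (sym (⊕-identityʳ _)) (unscale (suc m) (digitSum D m) zeroφ (ℕ→Zφ N) Dm≡N))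
                  (proj₂ (fractional-part-Between no11 m))

special-from-Bergman : ∀ {m n N D} → No11 D → ZeroFrom n D → m ℕ.≤ n → 1 ℕ.≤ N →
  D m ≡ false → D (suc m) ≡ false → D (2 ℕ.+ m) ≡ false →
  digitSum D n ≡ iter mulφ (suc m) (ℕ→Zφ N) →
  ∃ λ E → IsSpecialAt (suc m) E × ZeroFrom n E × digitSum E n ≡ digitSum D n
special-from-Bergman {m} {n} {N} {D} no11 zero-from m≤n 1≤N d0 d1 d2 D≡N
  with first-true (λ t → D (3 ℕ.+ t ℕ.+ m)) n
... | inj₁ none = ⊥-elim (Bergman-nonzero-above no11 1≤N m≤n gap D≡N)
  where
    gap : ∀ i → i ℕ.< n ℕ.∸ m → D (i ℕ.+ m) ≡ false
    gap i i<n∸m = gap-offsets {m} {n} {D} d0 d1 d2 none i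
                    (ℕP.≤-trans i<n∸m (ℕP.≤-trans (ℕP.m∸n≤m n m) (ℕP.m≤n+m n 3)))
... | inj₂ (t , _ , Dt , before) with parity t
...   | even s =
  special-by-uncarries s D (Dt , offsets⇒range (gap-offsets {m} {t} {D} d0 d1 d2 before) , λ k _ → no11 k) zero-from
...   | odd  s = ⊥-elim (Bergman-no-odd-gap s no11 zero-from (gap-offsets {m} {t} {D} d0 d1 d2 before) Dt D≡N)

-- Expansions indexed by ℤ

ix : ℕ → ℕ → ℤ
ix M k = - (+ M) + + k

shift : ℕ → (ℤ → Bool) → ℕ → Bool
shift M c k = c (ix M k)

ix-+ : ∀ M r n → ix M r + + n ≡ ix M (n ℕ.+ r)
ix-+ M r n = trans (h (- (+ M)) (+ r) (+ n)) (cong (λ x → - (+ M) + x) (sym (ℤP.pos-+ n r)))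
  where h : ∀ a b c → (a + b) + c ≡ a + (c + b)
        h = solve-∀

ix-suc : ∀ M k → ix M (suc k) ≡ ix M k + 1ℤ
ix-suc M k = sym (ix-+ M k 1)

ix-M : ∀ M → ix M M ≡ 0ℤ
ix-M M = ℤP.+-inverseˡ (+ M)

ix-1+M : ∀ M → ix M (suc M) ≡ 1ℤ
ix-1+M M = trans (ix-suc M M) (cong (_+ 1ℤ) (ix-M M))

ix-m : ∀ m → ix (suc m) m ≡ -1ℤ
ix-m m = trans (sym (h (ix (suc m) m))) (cong (_+ -1ℤ) (trans (sym (ix-suc (suc m) m)) (ix-M (suc m))))
  where h : ∀ x → (x + 1ℤ) + -1ℤ ≡ x
        h = solve-∀

ix≡0⇒M : ∀ M k → ix M k ≡ 0ℤ → k ≡ M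
ix≡0⇒M M k ix≡0 =
  ℤP.+-injective (trans (sym (h (+ M) (+ k))) (trans (cong (λ x → + M + x) ix≡0) (ℤP.+-identityʳ (+ M))))
  where h : ∀ x y → x + (- x + y) ≡ y
        h = solve-∀

ix-mono-< : ∀ M {k l} → k ℕ.< l → ix M k ℤ.< ix M l
ix-mono-< M k<l = ℤP.+-monoʳ-< (- (+ M)) (ℤ.+<+ k<l)

ix-mono-≤ : ∀ M {k l} → k ℕ.≤ l → ix M k ℤ.≤ ix M l
ix-mono-≤ M k≤l = ℤP.+-monoʳ-≤ (- (+ M)) (ℤ.+≤+ k≤l)

mulφ-φ^ : ∀ i → mulφ (φ^ i) ≡ φ^ (i + 1ℤ)
mulφ-φ^ (+ n)          = cong (λ k → iter mulφ k oneφ) (ℕP.+-comm 1 n)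
mulφ-φ^ -[1+ zero ]    = mulφ-divφ oneφ
mulφ-φ^ -[1+ suc n ]   = mulφ-divφ _

iter-mulφ-φ^ : ∀ k i → iter mulφ k (φ^ i) ≡ φ^ (i + + k)
iter-mulφ-φ^ zero    i = cong φ^ (sym (ℤP.+-identityʳ i))
iter-mulφ-φ^ (suc k) i =
  trans (cong mulφ (iter-mulφ-φ^ k i)) (trans (mulφ-φ^ (i + + k)) (cong φ^ (h i (+ k))))
  where h : ∀ i k → (i + k) + 1ℤ ≡ i + (1ℤ + k)
        h = solve-∀

iter-mulφ-φ^-ix : ∀ M k → iter mulφ M (φ^ (ix M k)) ≡ φ^ (+ k)
iter-mulφ-φ^-ix M k = trans (iter-mulφ-φ^ M (ix M k)) (cong φ^ (h (+ M) (+ k)))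
  where h : ∀ m k → (- m + k) + m ≡ k
        h = solve-∀

digitSum-shift-windowSum : ∀ c M r → ∀ n →
  digitSum (shift M c) r ⊕ iter mulφ M (windowSum c (ix M r) n) ≡ digitSum (shift M c) (n ℕ.+ r)
digitSum-shift-windowSum c M r zero =
  trans (cong (digitSum (shift M c) r ⊕_) (iter-fix mulφ refl M)) (⊕-identityʳ _)
digitSum-shift-windowSum c M r (suc n) = begin
  S r ⊕ iter mulφ M (W ⊕ digit b (φ^ (ix M r + + n)))
    ≡⟨ cong (S r ⊕_) (iter-⊕ mulφ mulφ-⊕ M W _) ⟩
  S r ⊕ (iter mulφ M W ⊕ iter mulφ M (digit b (φ^ (ix M r + + n))))
    ≡⟨ sym (⊕-assoc (S r) (iter mulφ M W) _) ⟩
  (S r ⊕ iter mulφ M W) ⊕ iter mulφ M (digit b (φ^ (ix M r + + n)))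
    ≡⟨ cong₂ _⊕_ (digitSum-shift-windowSum c M r n) (iter-digit M b _) ⟩
  S (n ℕ.+ r) ⊕ digit b (iter mulφ M (φ^ (ix M r + + n)))
    ≡⟨ cong (λ i → S (n ℕ.+ r) ⊕ digit (c i) (iter mulφ M (φ^ i))) (ix-+ M r n) ⟩
  S (n ℕ.+ r) ⊕ digit (shift M c (n ℕ.+ r)) (iter mulφ M (φ^ (ix M (n ℕ.+ r))))
    ≡⟨ cong (λ u → S (n ℕ.+ r) ⊕ digit (shift M c (n ℕ.+ r)) u) (iter-mulφ-φ^-ix M (n ℕ.+ r)) ⟩
  S (suc n ℕ.+ r)
    ∎
  where
    open ≡-Reasoning
    S : ℕ → Zφ
    S = digitSum (shift M c)
    W : Zφ
    W = windowSum c (ix M r) n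
    b : Bool
    b = c (ix M r + + n)

value-shift : ∀ (e : Expansion) M r L → Expansion.R e ≡ ix M r → Expansion.n e ℕ.+ r ℕ.≤ L →
              iter mulφ M (value e) ≡ digitSum (shift M (Expansion.c e)) L
value-shift e M r L R≡ n+r≤L = begin
  iter mulφ M (value e)
    ≡⟨ sym (⊕-identityˡ _) ⟩
  zeroφ ⊕ iter mulφ M (windowSum c (Expansion.R e) n)
    ≡⟨ cong₂ (λ u R → u ⊕ iter mulφ M (windowSum c R n)) (sym (digitSum-zeros r below)) R≡ ⟩
  digitSum (shift M c) r ⊕ iter mulφ M (windowSum c (ix M r) n)
    ≡⟨ digitSum-shift-windowSum c M r n ⟩
  digitSum (shift M c) (n ℕ.+ r)
    ≡⟨ sym (digitSum-gap (shift M c) s (n ℕ.+ r) (λ i _ → above i)) ⟩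
  digitSum (shift M c) (s ℕ.+ (n ℕ.+ r))
    ≡⟨ cong (digitSum (shift M c)) s+n+r≡L ⟩
  digitSum (shift M c) L
    ∎
  where
    open ≡-Reasoning
    c : ℤ → Bool
    c = Expansion.c e
    n : ℕ
    n = Expansion.n e
    s : ℕ
    s = proj₁ (ℕP.m≤n⇒∃[o]m+o≡n n+r≤L)
    s+n+r≡L : s ℕ.+ (n ℕ.+ r) ≡ L
    s+n+r≡L = trans (ℕP.+-comm s _) (proj₂ (ℕP.m≤n⇒∃[o]m+o≡n n+r≤L))
    below : ∀ k → k ℕ.< r → shift M c k ≡ false
    below k k<r = Expansion.support e _ (inj₁ (subst (ix M k ℤ.<_) (sym R≡) (ix-mono-< M k<r)))
    above : ∀ i → shift M c (i ℕ.+ (n ℕ.+ r)) ≡ false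
    above i = Expansion.support e _ (inj₂ (subst (ℤ._≤ ix M (i ℕ.+ (n ℕ.+ r)))
                (sym (trans (cong (_+ + n) R≡) (ix-+ M r n))) (ix-mono-≤ M (ℕP.m≤n+m _ i))))

shift-ZeroFrom : ∀ (e : Expansion) M r → Expansion.R e ≡ ix M r →
                 ZeroFrom (Expansion.n e ℕ.+ r) (shift M (Expansion.c e))
shift-ZeroFrom e M r R≡ k n+r≤k = Expansion.support e _ (inj₂ (subst (ℤ._≤ ix M k)
  (sym (trans (cong (_+ + Expansion.n e) R≡) (ix-+ M r (Expansion.n e)))) (ix-mono-≤ M n+r≤k)))

span : Expansion → ℕ
span e = ∣ Expansion.R e ∣ ℕ.+ Expansion.n e

index-window : ∀ R n M → ∣ R ∣ ℕ.≤ M → ∃ λ r → R ≡ ix M r × n ℕ.+ r ℕ.≤ M ℕ.+ (∣ R ∣ ℕ.+ n)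
index-window (+ a) n M _ =
  M ℕ.+ a , sym (trans (cong (λ x → - (+ M) + x) (ℤP.pos-+ M a)) (h (+ M) (+ a))) , ℕP.≤-reflexive (k n M a)
  where h : ∀ x y → - x + (x + y) ≡ y
        h = solve-∀
        k : ∀ n M a → n ℕ.+ (M ℕ.+ a) ≡ M ℕ.+ (a ℕ.+ n)
        k = ℕ-Solver.solve-∀
index-window -[1+ a ] n M 1+a≤M =
  M ℕ.∸ suc a , sym R≡ , ℕP.≤-trans (ℕP.≤-reflexive (ℕP.+-comm n _))
                           (ℕP.+-mono-≤ (ℕP.m∸n≤m M (suc a)) (ℕP.m≤n+m n (suc a)))
  where h : ∀ x y → - (x + y) + x ≡ - y
        h = solve-∀
        R≡ : ix M (M ℕ.∸ suc a) ≡ -[1+ a ]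
        R≡ = trans (cong (λ x → - x + + (M ℕ.∸ suc a))
                         (trans (cong +_ (sym (ℕP.m∸n+n≡m 1+a≤M))) (ℤP.pos-+ (M ℕ.∸ suc a) (suc a))))
                   (h (+ (M ℕ.∸ suc a)) (+ suc a))

shift-value : ∀ (e : Expansion) M → span e ℕ.≤ M →
  iter mulφ M (value e) ≡ digitSum (shift M (Expansion.c e)) (M ℕ.+ M) ×
  ZeroFrom (M ℕ.+ span e) (shift M (Expansion.c e))
shift-value e M span≤M =
  let (r , R≡ , n+r≤) = index-window (Expansion.R e) (Expansion.n e) M (ℕP.≤-trans (ℕP.m≤m+n _ _) span≤M)
  in value-shift e M r (M ℕ.+ M) R≡ (ℕP.≤-trans n+r≤ (ℕP.+-monoʳ-≤ M span≤M)) ,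
     λ k M+span≤k → shift-ZeroFrom e M r R≡ k (ℕP.≤-trans n+r≤ M+span≤k)

shift-at : ∀ c M k {i b} → ix M k ≡ i → c i ≡ b → shift M c k ≡ b
shift-at c M k refl ci≡b = ci≡b

at-shift : ∀ c M k {i b} → ix M k ≡ i → shift M c k ≡ b → c i ≡ b
at-shift c M k refl ck≡b = ck≡b

Has11-shift : ∀ {c M k} → Has11 (shift M c) k → Has11At c (ix M k)
Has11-shift {c} {M} {k} (has11 u l) = subst (λ i → c i ≡ true) (ix-suc M k) u , l

shift-No11 : ∀ {c} M → (∀ i → ¬ Has11At c i) → No11 (shift M c)
shift-No11 {c} M no11 k h = no11 (ix M k) (Has11-shift {c} {M} h)

shift-No11Except : ∀ {c} M → (∀ i → i ≢ 0ℤ → ¬ Has11At c i) → No11Except M (shift M c)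
shift-No11Except {c} M no11 k k≢M h = no11 (ix M k) (k≢M ∘ ix≡0⇒M M k) (Has11-shift {c} {M} h)

atℕ : (ℕ → Bool) → ℤ → Bool
atℕ d (+ k)      = d k
atℕ d -[1+ _ ]   = false

unshift : ℕ → (ℕ → Bool) → ℤ → Bool
unshift M d i = atℕ d (+ M + i)

shift-unshift : ∀ M d k → shift M (unshift M d) k ≡ d k
shift-unshift M d k = cong (atℕ d) (h (+ M) (+ k))
  where h : ∀ x y → x + (- x + y) ≡ y
        h = solve-∀

unshift-true : ∀ M d i → unshift M d i ≡ true → ∃ λ k → i ≡ ix M k
unshift-true M d i h with + M + i in M+i
... | + k = k , trans (sym (g (+ M) i)) (cong (λ x → - (+ M) + x) M+i)
  where g : ∀ x y → - x + (x + y) ≡ y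
        g = solve-∀
... | -[1+ _ ] with () ← h

unshift-No11Except : ∀ M d → No11Except M d → ∀ i → i ≢ 0ℤ → ¬ Has11At (unshift M d) i
unshift-No11Except M d no11 i i≢0 (u , l) with unshift-true M d i l
... | k , refl = no11 k (λ { refl → i≢0 (ix-M M) })
                   (has11 (trans (sym (trans (cong (unshift M d) (sym (ix-suc M k))) (shift-unshift M d (suc k)))) u)
                          (trans (sym (shift-unshift M d k)) l))

atℕ-negative : ∀ d {j} → j ℤ.< 0ℤ → atℕ d j ≡ false
atℕ-negative d {+ _}      (ℤ.+<+ ())
atℕ-negative d { -[1+ _ ]} _ = refl

atℕ-ZeroFrom : ∀ {L d} → ZeroFrom L d → ∀ {j} → + L ℤ.≤ j → atℕ d j ≡ false
atℕ-ZeroFrom zero-from (ℤ.+≤+ L≤k) = zero-from _ L≤k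

expansion : ∀ M L d → ZeroFrom L d → Expansion
expansion M L d zero-from = record { c = unshift M d ; R = - (+ M) ; n = L ; support = support }
  where
    support : ∀ i → i ℤ.< - (+ M) ⊎ - (+ M) + + L ℤ.≤ i → unshift M d i ≡ false
    support i (inj₁ i<-M) = atℕ-negative d (subst (+ M + i ℤ.<_) (ℤP.+-inverseʳ (+ M)) (ℤP.+-monoʳ-< (+ M) i<-M))
    support i (inj₂ -M+L≤i) =
      atℕ-ZeroFrom zero-from (subst (ℤ._≤ + M + i) (h (+ M) (+ L)) (ℤP.+-monoʳ-≤ (+ M) -M+L≤i))
      where h : ∀ x y → x + (- x + y) ≡ y
            h = solve-∀

value-expansion : ∀ M L d (zero-from : ZeroFrom L d) →
                  iter mulφ M (value (expansion M L d zero-from)) ≡ digitSum d L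
value-expansion M L d zero-from =
  trans (value-shift (expansion M L d zero-from) M 0 L (sym (ℤP.+-identityʳ (- (+ M))))
                     (ℕP.≤-reflexive (ℕP.+-identityʳ L)))
        (digitSum-cong L (λ k _ → shift-unshift M d k))

Bergman-zeros-if-special : ∀ {N} m (β e : Expansion) → span β ℕ.≤ m → span e ℕ.≤ m →
  IsBergman N β → IsSpecialRep N e →
  (Expansion.c β 1ℤ ≡ false) × (Expansion.c β 0ℤ ≡ false) × (Expansion.c β -1ℤ ≡ false)
Bergman-zeros-if-special m β e spanβ≤m spanₑ≤m (valβ , no11β) (valₑ , e1 , e0 , no11ₑ) =
  let (valueβ , _) = shift-value β M (ℕP.m≤n⇒m≤1+n spanβ≤m)
      (valueₑ , zero-fromₑ) = shift-value e M (ℕP.m≤n⇒m≤1+n spanₑ≤m)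
      (D-m , D-M , D-1+M) = Bergman-zeros-around-special
        (shift-at cₑ M M (ix-M M) e0 , shift-at cₑ M (suc M) (ix-1+M M) e1 , shift-No11Except M no11ₑ) zero-fromₑ
        (ℕP.+-monoʳ-< M (s≤s spanₑ≤m)) (shift-No11 M no11β)
        (trans (sym valueβ) (trans (cong (iter mulφ M) (trans valβ (sym valₑ))) valueₑ))
  in at-shift cβ M (suc M) (ix-1+M M) D-1+M , at-shift cβ M M (ix-M M) D-M , at-shift cβ M m (ix-m m) D-m
  where
    M : ℕ
    M = suc m
    cβ cₑ : ℤ → Bool
    cβ = Expansion.c β
    cₑ = Expansion.c e

special-if-Bergman-zeros : ∀ {N} → 1 ℕ.≤ N → (β : Expansion) → IsBergman N β →
  Expansion.c β 1ℤ ≡ false → Expansion.c β 0ℤ ≡ false → Expansion.c β -1ℤ ≡ false →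
  ∃ λ e → IsSpecialRep N e
special-if-Bergman-zeros {N} 1≤N β (valβ , no11β) c1 c0 c-1 =
  let (valueβ , zero-fromβ) = shift-value β M (ℕP.n≤1+n m)
      Dβ≡N = trans (sym valueβ) (cong (iter mulφ M) valβ)
      (E , (E-M , E-1+M , no11ᴱ) , zero-fromᴱ , E≡Dβ) = special-from-Bergman {m} {L} {N}
        (shift-No11 M no11β) (λ k L≤k → zero-fromβ k (ℕP.≤-trans (ℕP.+-monoʳ-≤ M (ℕP.n≤1+n m)) L≤k))
        (ℕP.≤-trans (ℕP.n≤1+n m) (ℕP.m≤m+n M M)) 1≤N
        (shift-at cβ M m (ix-m m) c-1) (shift-at cβ M M (ix-M M) c0) (shift-at cβ M (suc M) (ix-1+M M) c1) Dβ≡N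
  in expansion M L E zero-fromᴱ ,
     iter-mulφ-injective M (trans (value-expansion M L E zero-fromᴱ) (trans E≡Dβ Dβ≡N)) ,
     at-shift (unshift M E) M (suc M) (ix-1+M M) (trans (shift-unshift M E (suc M)) E-1+M) ,
     at-shift (unshift M E) M M (ix-M M) (trans (shift-unshift M E M) E-M) ,
     unshift-No11Except M E no11ᴱ
  where
    m M L : ℕ
    m = span β
    M = suc m
    L = M ℕ.+ M
    cβ : ℤ → Bool
    cβ = Expansion.c β

lemma1 : (N : ℕ) → N ≥ 1 → (β : Expansion) → IsBergman N β →
    ((∃ λ e → IsSpecialRep N e) ⇔
     ((Expansion.c β 1ℤ ≡ false) × (Expansion.c β 0ℤ ≡ false) × (Expansion.c β -1ℤ ≡ false)))
lemma1 N N≥1 β bergman = mk⇔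
  (λ (e , special) → Bergman-zeros-if-special (span β ℕ.+ span e) β e
                        (ℕP.m≤m+n (span β) (span e)) (ℕP.m≤n+m (span e) (span β)) bergman special)
  (λ (c1 , c0 , c-1) → special-if-Bergman-zeros N≥1 β bergman c1 c0 c-1)
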